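{- Let $\mathcal{I}$ be an ideal on $\omega$ such that $\mathcal{ED}\leq_{\mathsf{K}}\mathcal{I}$. Then either $\mathsf{fin}\times\mathsf{fin}\leq_{\mathsf{K}}\mathcal{I}$, or there is $X\in\mathcal{I}^{+}$ such that $\mathcal{ED}_{\mathsf{fin}}\leq_{\mathsf{K}}\mathcal{I}\upharpoonright X$.
   Context: An ideal on a set $S$ is a family $\mathcal{I}\subseteq\mathcal{P}(S)$ with $\emptyset\in\mathcal{I}$, $S\notin\mathcal{I}$, closed under subsets and finite unions; $\mathcal{I}^+=\mathcal{P}(S)\setminus\mathcal{I}$, $\mathcal{I}\upharpoonright X=\mathcal{P}(X)\cap\mathcal{I}$. $\mathcal{J}\leq_{\mathsf{K}}\mathcal{I}$ means there is $f$ from the underlying set of $\mathcal{I}$ to that of $\mathcal{J}$ with $f^{ -1}(A)\in\mathcal{I}$ for all $A\in\mathcal{J}$. With columns $C_n=\{n\}\times\omega$ and $D(f)=\{(n,m):m\leq f(n)\}$ for $f\in\omega^\omega$: $\mathcal{ED}$ is the ideal on $\omega\times\omega$ generated by the columns and graphs of functions $\omega\to\omega$; $\mathcal{ED}_{\mathsf{fin}}$ is its restriction to $\{(n,m):m\leq n\}$; $\mathsf{fin}\times\mathsf{fin}$ is the ideal on $\omega\times\omega$ generated by the columns and the sets $D(f)$, $f\in\omega^\omega$. -}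

module Defs where

open import Level using (Level; 0ℓ; _⊔_)
open import Data.Nat using (ℕ; _<_; _≤_)
open import Data.Fin using (Fin)
open import Data.Product using (Σ; ∃; _×_; _,_; proj₁; proj₂)
open import Data.Sum using (_⊎_)
open import Data.Empty using (⊥)
open import Data.Unit using (⊤)
open import Relation.Nullary using (¬_)
open import Relation.Binary.PropositionalEquality using (_≡_)

Subset : Set → Set₁
Subset S = S → Set

Family : Set → Set₁
Family S = Subset S → Set

_⊆_ : {S : Set} → Subset S → Subset S → Set
A ⊆ B = ∀ s → A s → B s

_∪_ : {S : Set} → Subset S → Subset S → Subset S
(A ∪ B) s = A s ⊎ B s

record Ideal (S : Set) : Set₁ where
  field
    mem      : Family S
    emptyMem : mem (λ _ → ⊥)
    fullNot  : ¬ mem (λ _ → ⊤)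
    downward : ∀ (A B : Subset S) → A ⊆ B → mem B → mem A
    unions   : ∀ (A B : Subset S) → mem A → mem B → mem (A ∪ B)
open Ideal public

Positive : {S : Set} → Family S → Subset S → Set
Positive I X = ¬ I X

-- Restriction I ↾ X = P(X) ∩ I, as a family of subsets of the
-- underlying set X (= Σ S X); a subset B of X is in I ↾ X iff,
-- viewed as a subset of S, it lies in I.
restrict : {S : Set} → Family S → (X : Subset S) → Family (Σ S X)
restrict I X B = I (λ s → Σ (X s) (λ x → B (s , x)))

_≤K_ : {S T : Set} → Family T → Family S → Set₁
_≤K_ {S} {T} J I = Σ (S → T) (λ f → ∀ (A : Subset T) → J A → I (λ s → A (f s)))

Grid : Set
Grid = ℕ × ℕ

-- ED: the ideal generated by the columns C_n = {n} × ω and the graphs of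
-- functions ω → ω, i.e. A ∈ ED iff A is contained in a finite union of
-- columns C_0,…,C_{k-1} and graphs of f_0,…,f_{m-1}.
ED : Family Grid
ED A = Σ ℕ λ k → Σ ℕ λ m → Σ (Fin m → ℕ → ℕ) λ fs →
  ∀ (a b : ℕ) → A (a , b) → (a < k) ⊎ (Σ (Fin m) λ i → fs i a ≡ b)

Δ : Subset Grid
Δ (n , m) = m ≤ n

EDfin : Family (Σ Grid Δ)
EDfin = restrict ED Δ

-- fin × fin: the ideal generated by the columns and the sets
-- D(f) = {(n,m) : m ≤ f n}.
FinFin : Family Grid
FinFin A = Σ ℕ λ k → Σ ℕ λ m → Σ (Fin m → ℕ → ℕ) λ fs →
  ∀ (a b : ℕ) → A (a , b) → (a < k) ⊎ (Σ (Fin m) λ i → b ≤ fs i a)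

{-# OPTIONS --safe #-}
module Submission where

-- Let f witness ED ≤K I and look at the preimages f⁻¹(D(h)). If all of them
-- lie in I, then f itself witnesses fin×fin ≤K I: every set in fin×fin is
-- covered by finitely many columns, whose preimage is in I because columns
-- are in ED, together with a single D(h). Otherwise X = f⁻¹(D(h)) is
-- I-positive for some h, and the shear (a , b) ↦ (a + h a , b) maps D(h)
-- into Δ and pulls columns and graphs back to columns and graphs, so
-- ED_fin ≤K ED ↾ D(h), and composing with f gives ED_fin ≤K I ↾ X.

open import Defs
open import Level using (Level)
open import Function using (_∘_)
open import Data.Nat using (ℕ; _+_; _<_; _≤_)
open import Data.Nat.Properties using (≤-trans; ≤-<-trans; m≤m+n; m≤n+m)
open import Data.List using (map; allFin)
open import Data.List.Extrema.Nat using (max; xs≤max)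
open import Data.List.Membership.Propositional.Properties using (∈-map⁺; ∈-allFin)
import Data.List.Relation.Unary.All as All
open import Data.Product using (Σ; _×_; _,_; proj₁)
open import Data.Sum using (_⊎_; inj₁; inj₂; map₁; map₂)
open import Axiom.ExcludedMiddle using (ExcludedMiddle)
open import Axiom.DoubleNegationElimination using (em⇒dne)
open import Relation.Nullary using (yes; no)

columns : ℕ → Subset Grid
columns k (a , _) = a < k

below : (ℕ → ℕ) → Subset Grid
below h (a , b) = b ≤ h a

≤K-trans : {S T U : Set} {I : Family S} {J : Family T} {K : Family U} →
  K ≤K J → J ≤K I → K ≤K I
≤K-trans (g , g-pre) (f , f-pre) = g ∘ f , λ A A∈K → f-pre _ (g-pre A A∈K)

restrict-≤K : {S T : Set} {I : Family S} {J : Family T} →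
  (w : J ≤K I) (Y : Subset T) → restrict J Y ≤K restrict I (Y ∘ proj₁ w)
restrict-≤K (f , f-pre) Y = (λ (s , y) → f s , y) , λ B → f-pre _

columns∈ED : ∀ k → ED (columns k)
columns∈ED k = k , 0 , (λ ()) , λ _ _ → inj₁

FinFin⊆columns∪below : ∀ {A} → FinFin A →
  Σ ℕ λ k → Σ (ℕ → ℕ) λ h → A ⊆ (columns k ∪ below h)
FinFin⊆columns∪below (k , m , fs , cover) =
  k , pointwiseMax ,
  λ (a , b) Aab → map₂ (λ (i , b≤fsi) → ≤-trans b≤fsi (≤pointwiseMax i)) (cover a b Aab)
  where
  pointwiseMax : ℕ → ℕ
  pointwiseMax a = max 0 (map (λ i → fs i a) (allFin m))

  ≤pointwiseMax : ∀ {a} i → fs i a ≤ pointwiseMax a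
  ≤pointwiseMax {a} i = All.lookup (xs≤max 0 _) (∈-map⁺ (λ j → fs j a) (∈-allFin i))

FinFin≤K-if-preimages-below∈I : {S : Set} (I : Ideal S) (f : S → Grid) →
  (∀ A → ED A → mem I (A ∘ f)) → (∀ h → mem I (below h ∘ f)) → FinFin ≤K mem I
FinFin≤K-if-preimages-below∈I I f f-pre below∈I = f , λ A A∈FinFin →
  let (k , h , A⊆) = FinFin⊆columns∪below A∈FinFin
  in downward I _ _ (λ s → A⊆ (f s)) (unions I _ _ (f-pre _ (columns∈ED k)) (below∈I h))

EDfin≤K-ED↾below : ∀ h → EDfin ≤K restrict ED (below h)
EDfin≤K-ED↾below h = shear , λ A (k , m , fs , cover) →
  k , m , (λ i a → fs i (a + h a)) ,
  λ a b (_ , A∋shear) → map₁ (≤-<-trans (m≤m+n a (h a))) (cover (a + h a) b (_ , A∋shear))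
  where
  shear : Σ Grid (below h) → Σ Grid Δ
  shear ((a , b) , b≤ha) = (a + h a , b) , ≤-trans b≤ha (m≤n+m (h a) a)

mainTheorem8 : (lem : ∀ {ℓ : Level} → ExcludedMiddle ℓ) → (I : Ideal ℕ) →
    ED ≤K mem I →
    (FinFin ≤K mem I) ⊎ (Σ (Subset ℕ) λ X → Positive (mem I) X × (EDfin ≤K restrict (mem I) X))
mainTheorem8 lem I ED≤KI@(f , f-pre)
  with lem {P = Σ (ℕ → ℕ) λ h → Positive (mem I) (below h ∘ f)}
... | yes (h , positive) =
  inj₂ (X , positive ,
        ≤K-trans {I = restrict (mem I) X} (EDfin≤K-ED↾below h) (restrict-≤K {I = mem I} ED≤KI (below h)))
  where
  X : Subset ℕ
  X = below h ∘ f
... | no ¬positive =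
  inj₁ (FinFin≤K-if-preimages-below∈I I f f-pre λ h → em⇒dne lem λ h∉I → ¬positive (h , h∉I))
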